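{- Let $G=(V,E)$ be a finite connected simple graph. Then $$\chi^{\mathrm{FAT}}(G)\leq \gcd\{\deg v: v\in V\}+1.$$ Moreover, if equality holds, then every FAT $\chi^{\mathrm{FAT}}(G)$-coloring of $G$ is a proper equitable coloring, i.e. a FAT coloring with $\beta=0$ (no vertex has a neighbor of its own color).
   Context: For $v\in V$ and $S\subseteq V$, let $e(v,S)$ denote the number of neighbors of $v$ in $S$. A vertex $k$-coloring of $G$ is a function $c:V\to\{1,\ldots,k\}$ with coloring classes $V_i=c^{ -1}(i)$. It is Fair and Tolerant (FAT) if there exists $\alpha\in[0,1]$ such that, with $\beta:=1-(k-1)\alpha$, for every vertex $v$ and every $i$ we have $e(v,V_i)=\alpha\deg v$ if $v\notin V_i$ and $e(v,V_i)=\beta\deg v$ if $v\in V_i$. A FAT coloring with $\beta=0$ is exactly a proper coloring in which every vertex has the same number $\deg v/(k-1)$ of neighbors in each other class; the paper calls such colorings proper equitable colorings. The FAT chromatic number $\chi^{\mathrm{FAT}}(G)$ is the largest integer $k$ such that $G$ admits a FAT $k$-coloring. -}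

module Defs where

open import Data.Nat using (ℕ; zero; suc; _∸_; _*_)
open import Data.Nat.GCD using (gcd)
open import Data.Fin using (Fin)
open import Data.Bool using (Bool; true; false; _∧_)
open import Data.List using (List; length; filterᵇ; foldr)
open import Data.Fin.Properties using () renaming (_≟_ to _≟ᶠ_)
open import Data.List using (allFin)
open import Data.Integer using (+_)
open import Data.Rational using (ℚ; 0ℚ; 1ℚ; _/_; _≤_; _-_) renaming (_*_ to _*ℚ_)
open import Data.Product using (Σ; _×_; ∃)
open import Relation.Binary.PropositionalEquality using (_≡_; _≢_)
open import Relation.Nullary using (does)

record SimpleGraph (n : ℕ) : Set where
  field
    Adj   : Fin n → Fin n → Bool
    sym   : ∀ u v → Adj u v ≡ Adj v u
    loopless : ∀ v → Adj v v ≡ false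
open SimpleGraph public

data Reach {n : ℕ} (G : SimpleGraph n) : Fin n → Fin n → Set where
  here : ∀ {u} → Reach G u u
  step : ∀ {u x w} → Adj G u x ≡ true → Reach G x w → Reach G u w

Connected : ∀ {n} → SimpleGraph n → Set
Connected {n} G = Fin n × (∀ u w → Reach G u w)

deg : ∀ {n} → SimpleGraph n → Fin n → ℕ
deg {n} G v = length (filterᵇ (Adj G v) (allFin n))

gcdDeg : ∀ {n} → SimpleGraph n → ℕ
gcdDeg {n} G = foldr (λ v acc → gcd (deg G v) acc) 0 (allFin n)

e : ∀ {n k} → SimpleGraph n → (Fin n → Fin k) → Fin n → Fin k → ℕ
e {n} G c v i = length (filterᵇ (λ u → Adj G v u ∧ does (c u ≟ᶠ i)) (allFin n))

ℕ→ℚ : ℕ → ℚ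
ℕ→ℚ m = (+ m) / 1

-- A vertex k-colouring: a map onto {1..k} (every colour class nonempty)
Surjective : ∀ {n k} → (Fin n → Fin k) → Set
Surjective {n} {k} c = ∀ (i : Fin k) → ∃ λ v → c v ≡ i

betaOf : ℕ → ℚ → ℚ
betaOf k α = 1ℚ - (ℕ→ℚ (k ∸ 1) *ℚ α)

IsFATWith : ∀ {n k} → SimpleGraph n → (Fin n → Fin k) → ℚ → Set
IsFATWith {n} {k} G c α =
  (0ℚ ≤ α) × (α ≤ 1ℚ) ×
  (∀ v i → (c v ≢ i → ℕ→ℚ (e G c v i) ≡ α *ℚ ℕ→ℚ (deg G v))
         × (c v ≡ i → ℕ→ℚ (e G c v i) ≡ betaOf k α *ℚ ℕ→ℚ (deg G v)))

IsFAT : ∀ {n k} → SimpleGraph n → (Fin n → Fin k) → Set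
IsFAT G c = Surjective c × Σ ℚ (IsFATWith G c)

AdmitsFAT : ∀ {n} → SimpleGraph n → ℕ → Set
AdmitsFAT {n} G k = Σ (Fin n → Fin k) (λ c → IsFAT G c)

IsFATChromaticNumber : ∀ {n} → SimpleGraph n → ℕ → Set
IsFATChromaticNumber G k = AdmitsFAT G k × (∀ k' → AdmitsFAT G k' → k' Data.Nat.≤ k)
  where import Data.Nat

-- Proper equitable colouring: proper, and each vertex has exactly deg v/(k-1)
-- neighbours in every other colour class (stated as (k-1)·e(v,V_i) = deg v).
IsProperEquitable : ∀ {n k} → SimpleGraph n → (Fin n → Fin k) → Set
IsProperEquitable {n} {k} G c =
  (∀ u v → Adj G u v ≡ true → c u ≢ c v) ×
  (∀ v i → c v ≢ i → (k ∸ 1) * e G c v i ≡ deg G v)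

-- For a FAT k-colouring with k ≥ 2 write α = p / q in lowest terms.  A vertex v
-- always has a colour class other than its own, in which it has p·deg v / q
-- neighbours, so q divides every degree and hence the gcd g.  Tolerance says
-- β ≥ 0, i.e. (k − 1)·p ≤ q, and connectivity yields an edge between two colour
-- classes, so p ≥ 1.  Hence k − 1 ≤ (k − 1)·p ≤ q ≤ g.  If k − 1 = g the chain
-- collapses to p = 1 and q = k − 1, which makes β = 0.

module Submission where

open import Defs hiding (sym)
open import Data.Nat as ℕ using (ℕ; suc; _+_; _*_; _∸_; _≤_; s≤s; NonZero; >-nonZero; ≢-nonZero⁻¹)
import Data.Nat.Properties as ℕP
open import Data.Nat.Divisibility using (_∣_; divides; ∣-trans; _∣0; ∣⇒≤; 0∣⇒≡0)
open import Data.Nat.GCD using (gcd; gcd[m,n]∣m; gcd[m,n]∣n; gcd-greatest)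
open import Data.Nat.Coprimality as C using (Coprime; coprime-divisor)
open import Data.Integer as ℤ using (+_; -[1+_])
import Data.Integer.Properties as ℤP
open import Data.Rational as ℚ using (ℚ; mkℚ; 1ℚ; *≤*)
import Data.Rational.Properties as ℚP
open import Data.Rational.Unnormalised using (mkℚᵘ; *≡*)
open import Data.Rational.Solver using (module +-*-Solver)
open import Data.Fin using (Fin; zero; suc)
open import Data.Fin.Properties using () renaming (_≟_ to _≟ᶠ_)
open import Data.Bool using (Bool; true; _∧_)
open import Data.Bool.Properties using (T-≡)
open import Data.List using ([]; _∷_; length; filterᵇ; foldr; allFin)
open import Data.List.Membership.Propositional using (_∈_)
open import Data.List.Membership.Propositional.Properties using (∈-allFin; ∈-filter⁺; ∈-length)
open import Data.List.Relation.Unary.Any using (here; there)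
open import Data.Product using (_×_; _,_; ∃; ∃₂; proj₁; proj₂)
open import Function using (_∘_; Equivalence)
open import Relation.Nullary using (contradiction; does; yes; no)
open import Relation.Nullary.Decidable using (T?; dec-true)
open import Relation.Binary.PropositionalEquality

ℕ→ℚ-mkℚ : ∀ m → ℕ→ℚ m ≡ mkℚ (+ m) 0 (C.sym (C.1-coprimeTo m))
ℕ→ℚ-mkℚ m = ℚP.normalize-coprime (C.sym (C.1-coprimeTo m))

ℕ→ℚ-injective : ∀ {a b} → ℕ→ℚ a ≡ ℕ→ℚ b → a ≡ b
ℕ→ℚ-injective {a} {b} eq = ℤP.+-injective (cong ℚ.↥_ (trans (sym (ℕ→ℚ-mkℚ a)) (trans eq (ℕ→ℚ-mkℚ b))))

ℕ→ℚ-homo-+ : ∀ a b → ℕ→ℚ (a + b) ≡ ℕ→ℚ a ℚ.+ ℕ→ℚ b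
ℕ→ℚ-homo-+ a b = begin
  ℕ→ℚ (a + b)                         ≡⟨ cong (ℚ._/ 1) (cong₂ ℤ._+_ (ℤP.*-identityʳ (+ a)) (ℤP.*-identityʳ (+ b))) ⟨
  (+ a ℤ.* + 1 ℤ.+ + b ℤ.* + 1) ℚ./ 1 ≡⟨ cong₂ ℚ._+_ (ℕ→ℚ-mkℚ a) (ℕ→ℚ-mkℚ b) ⟨
  ℕ→ℚ a ℚ.+ ℕ→ℚ b                     ∎
  where open ≡-Reasoning

ℕ→ℚ-homo-* : ∀ a b → ℕ→ℚ (a * b) ≡ ℕ→ℚ a ℚ.* ℕ→ℚ b
ℕ→ℚ-homo-* a b = begin
  ℕ→ℚ (a * b)          ≡⟨ cong (ℚ._/ 1) (ℤP.pos-* a b) ⟩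
  (+ a ℤ.* + b) ℚ./ 1  ≡⟨ cong₂ ℚ._*_ (ℕ→ℚ-mkℚ a) (ℕ→ℚ-mkℚ b) ⟨
  ℕ→ℚ a ℚ.* ℕ→ℚ b      ∎
  where open ≡-Reasoning

cross⇒/-≡ : ∀ {i j m-1 n-1} → i ℤ.* + suc n-1 ≡ j ℤ.* + suc m-1 → i ℚ./ suc m-1 ≡ j ℚ./ suc n-1
cross⇒/-≡ {i} {j} {m-1} {n-1} eq = ℚP.fromℚᵘ-cong {mkℚᵘ i m-1} {mkℚᵘ j n-1} (*≡* eq)

mkℚ-*-denominator : ∀ p q-1 .(cp : Coprime p (suc q-1)) → mkℚ (+ p) q-1 cp ℚ.* ℕ→ℚ (suc q-1) ≡ ℕ→ℚ p
mkℚ-*-denominator p q-1 cp = begin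
  mkℚ (+ p) q-1 cp ℚ.* ℕ→ℚ (suc q-1)        ≡⟨ cong (mkℚ (+ p) q-1 cp ℚ.*_) (ℕ→ℚ-mkℚ (suc q-1)) ⟩
  (+ p ℤ.* + suc q-1) ℚ./ suc (q-1 * 1)    ≡⟨ cross⇒/-≡ {+ p ℤ.* + suc q-1} {+ p} {q-1 * 1} {0} cross ⟩
  ℕ→ℚ p                                    ∎
  where
  open ≡-Reasoning
  cross : (+ p ℤ.* + suc q-1) ℤ.* + 1 ≡ + p ℤ.* + suc (q-1 * 1)
  cross = trans (ℤP.*-identityʳ _) (cong (λ m → + p ℤ.* + suc m) (sym (ℕP.*-identityʳ q-1)))

module _ (p q-1 : ℕ) .(cp : Coprime p (suc q-1)) where

  open +-*-Solver using (solve; _:*_; _:+_; _:-_; con; _:=_)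

  private
    α : ℚ
    α = mkℚ (+ p) q-1 cp
    q : ℕ
    q = suc q-1

  fair-cleared : ∀ {E D} → ℕ→ℚ E ≡ α ℚ.* ℕ→ℚ D → E * q ≡ p * D
  fair-cleared {E} {D} eq = ℕ→ℚ-injective (begin
    ℕ→ℚ (E * q)                  ≡⟨ ℕ→ℚ-homo-* E q ⟩
    ℕ→ℚ E ℚ.* ℕ→ℚ q              ≡⟨ cong (ℚ._* ℕ→ℚ q) eq ⟩
    α ℚ.* ℕ→ℚ D ℚ.* ℕ→ℚ q        ≡⟨ solve 3 (λ a d q → a :* d :* q := a :* q :* d) refl α (ℕ→ℚ D) (ℕ→ℚ q) ⟩
    α ℚ.* ℕ→ℚ q ℚ.* ℕ→ℚ D        ≡⟨ cong (ℚ._* ℕ→ℚ D) (mkℚ-*-denominator p q-1 cp) ⟩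
    ℕ→ℚ p ℚ.* ℕ→ℚ D              ≡⟨ ℕ→ℚ-homo-* p D ⟨
    ℕ→ℚ (p * D)                  ∎)
    where open ≡-Reasoning

  tolerant-cleared : ∀ k {E D} → ℕ→ℚ E ≡ betaOf k α ℚ.* ℕ→ℚ D → E * q + (k ∸ 1) * p * D ≡ q * D
  tolerant-cleared k {E} {D} eq = ℕ→ℚ-injective (begin
    ℕ→ℚ (E * q + K * p * D)
      ≡⟨ trans (ℕ→ℚ-homo-+ (E * q) (K * p * D))
               (cong₂ ℚ._+_ (ℕ→ℚ-homo-* E q) (trans (ℕ→ℚ-homo-* (K * p) D) (cong (ℚ._* ℕ→ℚ D) (ℕ→ℚ-homo-* K p)))) ⟩
    ℕ→ℚ E ℚ.* ℕ→ℚ q ℚ.+ ℕ→ℚ K ℚ.* ℕ→ℚ p ℚ.* ℕ→ℚ D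
      ≡⟨ cong₂ (λ x y → x ℚ.* ℕ→ℚ q ℚ.+ ℕ→ℚ K ℚ.* y ℚ.* ℕ→ℚ D) eq (sym (mkℚ-*-denominator p q-1 cp)) ⟩
    betaOf k α ℚ.* ℕ→ℚ D ℚ.* ℕ→ℚ q ℚ.+ ℕ→ℚ K ℚ.* (α ℚ.* ℕ→ℚ q) ℚ.* ℕ→ℚ D
      ≡⟨ solve 4 (λ k a d q → (con 1ℚ :- k :* a) :* d :* q :+ k :* (a :* q) :* d := q :* d) refl (ℕ→ℚ K) α (ℕ→ℚ D) (ℕ→ℚ q) ⟩
    ℕ→ℚ q ℚ.* ℕ→ℚ D
      ≡⟨ ℕ→ℚ-homo-* q D ⟨
    ℕ→ℚ (q * D)
      ∎)
    where
    open ≡-Reasoning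
    K : ℕ
    K = k ∸ 1

filterᵇ-allFin-nonZero : ∀ {n} (P : Fin n → Bool) {x} → P x ≡ true → NonZero (length (filterᵇ P (allFin n)))
filterᵇ-allFin-nonZero P {x} Px = >-nonZero (∈-length (∈-filter⁺ (T? ∘ P) (∈-allFin x) (Equivalence.from T-≡ Px)))

foldr-gcd∣ : ∀ {A : Set} (f : A → ℕ) {x xs} → x ∈ xs → foldr (λ v acc → gcd (f v) acc) 0 xs ∣ f x
foldr-gcd∣ f {xs = y ∷ _} (here refl) = gcd[m,n]∣m (f y) _
foldr-gcd∣ f {xs = y ∷ _} (there x∈ys) = ∣-trans (gcd[m,n]∣n (f y) _) (foldr-gcd∣ f x∈ys)

∣-foldr-gcd : ∀ {A : Set} (f : A → ℕ) xs {d} → (∀ x → d ∣ f x) → d ∣ foldr (λ v acc → gcd (f v) acc) 0 xs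
∣-foldr-gcd f []       d∣f = _ ∣0
∣-foldr-gcd f (y ∷ ys) d∣f = gcd-greatest (d∣f y) (∣-foldr-gcd f ys d∣f)

∣-nonZero : ∀ {m n} → m ∣ n → NonZero n → NonZero m
∣-nonZero {ℕ.zero} m∣n n≢0 = subst NonZero (0∣⇒≡0 m∣n) n≢0
∣-nonZero {suc _}  _   _   = _

module _ {n : ℕ} (G : SimpleGraph n) where

  deg-nonZero : ∀ {u w} → Adj G u w ≡ true → NonZero (deg G u)
  deg-nonZero = filterᵇ-allFin-nonZero (Adj G _)

  e-nonZero : ∀ {k} (c : Fin n → Fin k) {u w} → Adj G u w ≡ true → NonZero (e G c u (c w))
  e-nonZero c {u} {w} uw = filterᵇ-allFin-nonZero (λ x → Adj G u x ∧ does (c x ≟ᶠ c w)) (cong₂ _∧_ uw (dec-true (c w ≟ᶠ c w) refl))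

  gcdDeg∣deg : ∀ v → gcdDeg G ∣ deg G v
  gcdDeg∣deg v = foldr-gcd∣ (deg G) (∈-allFin v)

  gcdDeg≢0 : ∀ {u w} → Adj G u w ≡ true → NonZero (gcdDeg G)
  gcdDeg≢0 {u} uw = ∣-nonZero (gcdDeg∣deg u) (deg-nonZero uw)

  ∣-gcdDeg : ∀ {d} → (∀ v → d ∣ deg G v) → d ∣ gcdDeg G
  ∣-gcdDeg = ∣-foldr-gcd (deg G) (allFin n)

  Bichromatic : ∀ {k} → (Fin n → Fin k) → Set
  Bichromatic c = ∃₂ λ u w → Adj G u w ≡ true × c u ≢ c w

  walk-bichromatic : ∀ {k} (c : Fin n → Fin k) {u w} → Reach G u w → c u ≢ c w → Bichromatic c
  walk-bichromatic c here              cu≢cw = contradiction refl cu≢cw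
  walk-bichromatic c {u} (step {x = x} ux walk) cu≢cw with c u ≟ᶠ c x
  ... | yes cu≡cx = walk-bichromatic c walk (cu≢cw ∘ trans cu≡cx)
  ... | no  cu≢cx = u , x , ux , cu≢cx

  surjective-bichromatic : ∀ {k} → Connected G → (c : Fin n → Fin (suc (suc k))) → Surjective c → Bichromatic c
  surjective-bichromatic (_ , reach) c surj with surj zero | surj (suc zero)
  ... | u , cu≡0 | w , cw≡1 = walk-bichromatic c (reach u w) λ cu≡cw → 0≢1 (trans (sym cu≡0) (trans cu≡cw cw≡1))
    where
    0≢1 : zero ≢ suc zero
    0≢1 ()

-- The FAT equations for α = p / q in lowest terms, multiplied through by q.
record ClearedFAT {n k} (G : SimpleGraph n) (c : Fin n → Fin k) : Set where
  field
    p q         : ℕ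
    {{q≢0}}     : NonZero q
    q⊥p         : Coprime q p
    fair        : ∀ v i → c v ≢ i → e G c v i * q ≡ p * deg G v
    tolerant    : ∀ v → e G c v (c v) * q + (k ∸ 1) * p * deg G v ≡ q * deg G v

clear-denominators : ∀ {n k} {G : SimpleGraph n} {c : Fin n → Fin k} (α : ℚ) → IsFATWith G c α → ClearedFAT G c
clear-denominators (mkℚ -[1+ _ ] _   _)  (*≤* () , _)
clear-denominators {k = k} {G} {c} (mkℚ (+ p) q-1 cp) (_ , _ , fat) = record
  { p        = p
  ; q        = suc q-1
  ; q⊥p      = C.sym (C.recompute cp)
  ; fair     = λ v i cv≢i → fair-cleared p q-1 cp {e G c v i} {deg G v} (proj₁ (fat v i) cv≢i)
  ; tolerant = λ v → tolerant-cleared p q-1 cp k {e G c v (c v)} {deg G v} (proj₂ (fat v (c v)) refl)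
  }

module ClearedFATProperties {n k} {G : SimpleGraph n} {c : Fin n → Fin k} (fat : ClearedFAT G c) where

  open ClearedFAT fat

  q∣deg : ∀ {v i} → c v ≢ i → q ∣ deg G v
  q∣deg {v} {i} cv≢i = coprime-divisor q⊥p (divides (e G c v i) (sym (fair v i cv≢i)))

  p≢0 : ∀ {u w} → Adj G u w ≡ true → c u ≢ c w → NonZero p
  p≢0 {u} {w} uw cu≢cw = ℕP.m*n≢0⇒m≢0 p {{subst NonZero (fair u (c w) cu≢cw) (ℕP.m*n≢0 _ q {{e-nonZero G c uw}})}}

  [k-1]p≤q : ∀ {u w} → Adj G u w ≡ true → (k ∸ 1) * p ≤ q
  [k-1]p≤q {u} uw = ℕP.*-cancelʳ-≤ _ q (deg G u) {{deg-nonZero G uw}}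
    (subst ((k ∸ 1) * p * deg G u ≤_) (tolerant u) (ℕP.m≤n+m _ _))

  own-colour-free : p ≡ 1 → q ≡ k ∸ 1 → ∀ v → e G c v (c v) ≡ 0
  own-colour-free refl refl v = ℕP.m*n≡0⇒m≡0 _ q (ℕP.+-cancelʳ-≡ (q * deg G v) _ 0 (begin
    e G c v (c v) * q + q * deg G v       ≡⟨ cong (λ m → e G c v (c v) * q + m * deg G v) (ℕP.*-identityʳ q) ⟨
    e G c v (c v) * q + q * 1 * deg G v   ≡⟨ tolerant v ⟩
    q * deg G v                           ∎))
    where open ≡-Reasoning

  α≡1/[k-1]⇒properEquitable : p ≡ 1 → q ≡ k ∸ 1 → IsProperEquitable G c
  α≡1/[k-1]⇒properEquitable p≡1 q≡k-1 = proper , equitable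
    where
    proper : ∀ u v → Adj G u v ≡ true → c u ≢ c v
    proper u v uv cu≡cv = ≢-nonZero⁻¹ _ {{subst (λ i → NonZero (e G c u i)) (sym cu≡cv) (e-nonZero G c uv)}}
                                            (own-colour-free p≡1 q≡k-1 u)
    equitable : ∀ v i → c v ≢ i → (k ∸ 1) * e G c v i ≡ deg G v
    equitable v i cv≢i = begin
      (k ∸ 1) * e G c v i   ≡⟨ cong (_* e G c v i) q≡k-1 ⟨
      q * e G c v i         ≡⟨ ℕP.*-comm q _ ⟩
      e G c v i * q         ≡⟨ fair v i cv≢i ⟩
      p * deg G v           ≡⟨ cong (_* deg G v) p≡1 ⟩
      1 * deg G v           ≡⟨ ℕP.*-identityˡ _ ⟩
      deg G v               ∎
      where open ≡-Reasoning

  q≤gcdDeg : (∀ v → ∃ λ i → c v ≢ i) → ∀ {u w} → Adj G u w ≡ true → q ≤ gcdDeg G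
  q≤gcdDeg other uw = ∣⇒≤ {{gcdDeg≢0 G uw}} (∣-gcdDeg G λ v → q∣deg (proj₂ (other v)))

module SeveralColours {n k} {G : SimpleGraph n} (conn : Connected G) {c : Fin n → Fin (suc (suc k))}
                      (surj : Surjective c) (fat : ClearedFAT G c) where

  open ClearedFAT fat
  open ClearedFATProperties fat

  private
    other : ∀ (x : Fin (suc (suc k))) → ∃ λ i → x ≢ i
    other zero    = suc zero , λ ()
    other (suc _) = zero , λ ()

  colour-chain : suc k ≤ suc k * p × suc k * p ≤ q × q ≤ gcdDeg G
  colour-chain with surjective-bichromatic G conn c surj
  ... | _ , _ , uw , cu≢cw = ℕP.m≤m*n (suc k) p {{p≢0 uw cu≢cw}} , [k-1]p≤q uw , q≤gcdDeg (other ∘ c) uw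

  colours≤1+gcdDeg : suc (suc k) ≤ suc (gcdDeg G)
  colours≤1+gcdDeg = let k≤kp , kp≤q , q≤g = colour-chain in s≤s (ℕP.≤-trans k≤kp (ℕP.≤-trans kp≤q q≤g))

  gcdDeg≤colours-1⇒properEquitable : gcdDeg G ≤ suc k → IsProperEquitable G c
  gcdDeg≤colours-1⇒properEquitable g≤k with colour-chain
  ... | k≤kp , kp≤q , q≤g = α≡1/[k-1]⇒properEquitable p≡1 q≡k
    where
    q≤k : q ≤ suc k
    q≤k = ℕP.≤-trans q≤g g≤k
    q≡k : q ≡ suc k
    q≡k = ℕP.≤-antisym q≤k (ℕP.≤-trans k≤kp kp≤q)
    kp≡k : suc k * p ≡ suc k
    kp≡k = ℕP.≤-antisym (ℕP.≤-trans kp≤q q≤k) k≤kp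
    p≡1 : p ≡ 1
    p≡1 = ℕP.*-cancelˡ-≡ p 1 (suc k) (trans kp≡k (sym (ℕP.*-identityʳ (suc k))))

module _ {n : ℕ} {G : SimpleGraph n} (conn : Connected G) where

  FAT-colours≤1+gcdDeg : ∀ k → AdmitsFAT G k → k ≤ suc (gcdDeg G)
  FAT-colours≤1+gcdDeg 0             (c , _)              = contradiction (c (proj₁ conn)) λ ()
  FAT-colours≤1+gcdDeg 1             _                    = s≤s ℕ.z≤n
  FAT-colours≤1+gcdDeg (suc (suc k)) (c , surj , α , fat) =
    SeveralColours.colours≤1+gcdDeg conn surj (clear-denominators α fat)

  FAT-colouring-properEquitable : ∀ {k} → gcdDeg G ≡ k → (c : Fin n → Fin (suc k)) → IsFAT G c → IsProperEquitable G c
  FAT-colouring-properEquitable {0} g≡0 c _ = proper , λ v i cv≢i → contradiction (trans (only (c v)) (sym (only i))) cv≢i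
    where
    only : (i : Fin 1) → i ≡ zero
    only zero = refl
    proper : ∀ u v → Adj G u v ≡ true → c u ≢ c v
    proper u v uv _ = ≢-nonZero⁻¹ _ {{gcdDeg≢0 G uv}} g≡0
  FAT-colouring-properEquitable {suc k} g≡k c (surj , α , fat) =
    SeveralColours.gcdDeg≤colours-1⇒properEquitable conn surj (clear-denominators α fat) (ℕP.≤-reflexive g≡k)

theorem2p18 : ∀ {n} (G : SimpleGraph n) → Connected G → (χ : ℕ) → IsFATChromaticNumber G χ →
    (χ ≤ suc (gcdDeg G))
    × (χ ≡ suc (gcdDeg G) → (c : Fin n → Fin χ) → IsFAT G c → IsProperEquitable G c)
theorem2p18 G conn χ (admits , _) =
  FAT-colours≤1+gcdDeg conn χ admits , λ { refl → FAT-colouring-properEquitable conn refl }
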